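{- Let $\Gamma$ be a finite connected $4$-valent graph with vertex set $X$ and $G\le\mathrm{Aut}(\Gamma)$ such that $\Gamma$ is $G$-oriented and $(\Gamma,G)$ is basic of biquasiprimitive type. Then $\Gamma$ is bipartite with biparts $\Delta,\Delta'$; let $G^+$ be the subgroup of $G$ of index two with orbits $\Delta,\Delta'$. Then (a) $G^+$ acts faithfully on $\Delta$ (and on $\Delta'$); and (b) every nontrivial normal subgroup $N$ of $G$ that is intransitive on $X$ has exactly the two orbits $\Delta$ and $\Delta'$ on $X$; in particular $N\le G^+$.
   Context: All graphs are finite, simple and undirected. For $G\le\mathrm{Aut}(\Gamma)$, $\Gamma$ is $G$-oriented if $G$ is transitive on vertices and edges of $\Gamma$ but not on arcs. For $N\trianglelefteq G$, the normal quotient $\Gamma_N$ has the $N$-orbits as vertices, two orbits adjacent iff some edge of $\Gamma$ joins them. $(\Gamma,G)$ is basic of biquasiprimitive type if every nontrivial normal subgroup $N$ of $G$ has $\Gamma_N\cong K_1$ or $K_2$ and at least one has $\Gamma_N\cong K_2$; equivalently every nontrivial normal subgroup of $G$ has at most two vertex-orbits and some has exactly two. -}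

module Defs where

open import Level using (Level; suc; zero)
open import Data.Nat using (ℕ)
open import Data.Bool using (Bool; true; false)
open import Data.Fin using (Fin)
open import Data.List using (length; filterᵇ; allFin)
open import Data.Fin.Permutation using (Permutation′; _⟨$⟩ʳ_; id; flip; _∘ₚ_; _≈_)
open import Data.Product using (Σ; ∃; _×_; _,_)
open import Data.Sum using (_⊎_)
open import Relation.Binary.PropositionalEquality using (_≡_; _≢_)
open import Relation.Nullary using (¬_)

record Graph (n : ℕ) : Set where
  field
    adj     : Fin n → Fin n → Bool
    adj-sym : ∀ x y → adj x y ≡ adj y x
    adj-irr : ∀ x → adj x x ≡ false
open Graph public

module _ {n : ℕ} (Γ : Graph n) where

  Edge : Fin n → Fin n → Set
  Edge x y = adj Γ x y ≡ true

  degree : Fin n → ℕ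
  degree x = length (filterᵇ (adj Γ x) (allFin n))

  FourValent : Set
  FourValent = ∀ x → degree x ≡ 4

  data Walk : Fin n → Fin n → Set where
    here : ∀ {x} → Walk x x
    step : ∀ {x y z} → Edge x y → Walk y z → Walk x z

  Connected : Set
  Connected = ∀ x y → Walk x y

  IsAut : Permutation′ n → Set
  IsAut σ = ∀ x y → adj Γ (σ ⟨$⟩ʳ x) (σ ⟨$⟩ʳ y) ≡ adj Γ x y

record Subgroup (n : ℕ) : Set₁ where
  field
    _∈_     : Permutation′ n → Set
    ∈-resp  : ∀ {π ρ} → π ≈ ρ → _∈_ π → _∈_ ρ
    ∈-id    : _∈_ id
    ∈-comp  : ∀ {π ρ} → _∈_ π → _∈_ ρ → _∈_ (π ∘ₚ ρ)
    ∈-inv   : ∀ {π} → _∈_ π → _∈_ (flip π)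
open Subgroup public

module _ {n : ℕ} where

  _≤G_ : Subgroup n → Subgroup n → Set
  H ≤G K = ∀ π → _∈_ H π → _∈_ K π

  IsNormal : Subgroup n → Subgroup n → Set
  IsNormal N G = (N ≤G G) ×
    (∀ g ν → _∈_ G g → _∈_ N ν → _∈_ N ((flip g ∘ₚ ν) ∘ₚ g))

  Nontrivial : Subgroup n → Set
  Nontrivial N = Σ (Permutation′ n) λ ν → _∈_ N ν × ∃ λ x → ν ⟨$⟩ʳ x ≢ x

  SameOrbit : Subgroup n → Fin n → Fin n → Set
  SameOrbit H x y = Σ (Permutation′ n) λ h → _∈_ H h × h ⟨$⟩ʳ x ≡ y

  Transitive : Subgroup n → Set
  Transitive H = ∀ x y → SameOrbit H x y

  AtMostTwoOrbits : Subgroup n → Set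
  AtMostTwoOrbits H = Σ (Fin n) λ a → Σ (Fin n) λ b →
    ∀ x → SameOrbit H a x ⊎ SameOrbit H b x

  ExactlyTwoOrbits : Subgroup n → Set
  ExactlyTwoOrbits H = Σ (Fin n) λ a → Σ (Fin n) λ b →
    (¬ SameOrbit H a b) × (∀ x → SameOrbit H a x ⊎ SameOrbit H b x)

module _ {n : ℕ} (Γ : Graph n) (G : Subgroup n) where

  SubgroupOfAut : Set
  SubgroupOfAut = ∀ g → _∈_ G g → IsAut Γ g

  EdgeTransitive : Set
  EdgeTransitive = ∀ x y u v → Edge Γ x y → Edge Γ u v →
    Σ (Permutation′ n) λ g → _∈_ G g ×
      ((g ⟨$⟩ʳ x ≡ u × g ⟨$⟩ʳ y ≡ v) ⊎ (g ⟨$⟩ʳ x ≡ v × g ⟨$⟩ʳ y ≡ u))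

  ArcTransitive : Set
  ArcTransitive = ∀ x y u v → Edge Γ x y → Edge Γ u v →
    Σ (Permutation′ n) λ g → _∈_ G g × (g ⟨$⟩ʳ x ≡ u × g ⟨$⟩ʳ y ≡ v)

  Oriented : Set
  Oriented = Transitive G × EdgeTransitive × ¬ ArcTransitive

  BasicBiquasiprimitive : Set₁
  BasicBiquasiprimitive =
    (∀ N → IsNormal N G → Nontrivial N → AtMostTwoOrbits N) ×
    Σ (Subgroup n) λ N → IsNormal N G × Nontrivial N × ExactlyTwoOrbits N

-- A normal subgroup N₀ with two orbits has no edge inside an orbit: by normality and
-- edge-transitivity one such edge would put every edge inside an orbit, and connectivity would
-- make N₀ transitive. So the N₀-orbits properly 2-colour Γ. A proper 2-colouring of a connected
-- graph is unique up to swapping the colours; hence every automorphism preserves or swaps the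
-- classes, and every intransitive normal subgroup, whose orbits again 2-colour Γ, has the two
-- classes as orbits, which is (b). For (a), if the kernel K of G⁺ on one class were nontrivial,
-- the product of K with the kernel K′ on the other class would be a nontrivial normal subgroup
-- of G preserving the classes, so its orbits are the classes. Then K′ is transitive on the class
-- fixed by K and vice versa, and composing their elements carries any arc to any arc whose tail
-- lies in the same class; with a class-swapping element, G would be arc-transitive.

module Submission where

open import Defs
open import Data.Nat using (ℕ)
open import Data.Bool using (Bool; true; false; not)
open import Data.Bool.Properties using (¬-not; not-¬; not-injective) renaming (_≟_ to _≟ᵇ_)
open import Data.Fin using (Fin)
open import Data.Fin.Properties using () renaming (_≟_ to _≟ᶠ_)
open import Data.Fin.Permutation using (Permutation′; _⟨$⟩ʳ_; _⟨$⟩ˡ_; id; flip; _∘ₚ_; inverseˡ; inverseʳ)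
open import Data.Product using (Σ; ∃; _×_; _,_; proj₁; proj₂)
open import Data.Sum using (_⊎_; inj₁; inj₂; [_,_]′)
open import Function using (_∘_; const)
open import Function.Bundles using (_⇔_; mk⇔; Equivalence)
open import Relation.Binary.PropositionalEquality
  using (_≡_; _≢_; refl; sym; trans; cong; subst₂; module ≡-Reasoning)
open import Relation.Nullary using (¬_; yes; no; contradiction)

≡-not⇒≢ : ∀ {x y} → x ≡ not y → x ≢ y
≡-not⇒≢ x≡¬y x≡y = not-¬ x≡y x≡¬y

≢-common⇒≡ : ∀ {x y z : Bool} → x ≢ z → y ≢ z → x ≡ y
≢-common⇒≡ x≢z y≢z = trans (¬-not x≢z) (sym (¬-not y≢z))

both-colours-used : ∀ {A : Set} (c : A → Bool) {u v} → c u ≢ c v →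
                    (∃ λ x → c x ≡ true) × (∃ λ x → c x ≡ false)
both-colours-used c {u} {v} cu≢cv with c u in cu | c v in cv
... | true  | true  = contradiction refl cu≢cv
... | true  | false = (u , cu) , (v , cv)
... | false | true  = (v , cv) , (u , cu)
... | false | false = contradiction refl cu≢cv

module _ {n : ℕ} where

  _∈ₛ_ : Permutation′ n → Subgroup n → Set
  g ∈ₛ H = _∈_ H g

  Preserves : (Fin n → Bool) → Permutation′ n → Set
  Preserves c g = ∀ x → c (g ⟨$⟩ʳ x) ≡ c x

  Swaps : (Fin n → Bool) → Permutation′ n → Set
  Swaps c g = ∀ x → c (g ⟨$⟩ʳ x) ≢ c x

  FixesClass : (Fin n → Bool) → Bool → Permutation′ n → Set
  FixesClass c b g = ∀ x → c x ≡ b → g ⟨$⟩ʳ x ≡ x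

  -- _∘ₚ_ composes left to right: conjugate h m sends x to h (m (h⁻¹ x)).
  conjugate : Permutation′ n → Permutation′ n → Permutation′ n
  conjugate h m = (flip h ∘ₚ m) ∘ₚ h

  preserves-inverse : ∀ {c} g → Preserves c g → Preserves c (flip g)
  preserves-inverse {c} g pres x = trans (sym (pres (g ⟨$⟩ˡ x))) (cong c (inverseʳ g))

  swaps-inverse : ∀ {c} g → Swaps c g → ∀ x → c (g ⟨$⟩ˡ x) ≡ not (c x)
  swaps-inverse {c} g swaps x =
    ¬-not λ eq → swaps (g ⟨$⟩ˡ x) (trans (cong c (inverseʳ g)) (sym eq))

  moves-colour⇒swaps : ∀ {c g x} → Preserves c g ⊎ Swaps c g → c (g ⟨$⟩ʳ x) ≢ c x → Swaps c g
  moves-colour⇒swaps {x = x} (inj₁ pres) moved = contradiction (pres x) moved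
  moves-colour⇒swaps         (inj₂ swaps) _    = swaps

module _ {n : ℕ} (H : Subgroup n) where

  sameOrbit-refl : ∀ x → SameOrbit H x x
  sameOrbit-refl x = id , ∈-id H , refl

  sameOrbit-sym : ∀ {x y} → SameOrbit H x y → SameOrbit H y x
  sameOrbit-sym (h , h∈H , refl) = flip h , ∈-inv H h∈H , inverseˡ h

  sameOrbit-trans : ∀ {x y z} → SameOrbit H x y → SameOrbit H y z → SameOrbit H x z
  sameOrbit-trans (h , h∈H , refl) (k , k∈H , refl) = h ∘ₚ k , ∈-comp H h∈H k∈H , refl

  intransitive⇒exactlyTwoOrbits : AtMostTwoOrbits H → ¬ Transitive H → ExactlyTwoOrbits H
  intransitive⇒exactlyTwoOrbits (a , b , cover) intransitive = a , b , a≁b , cover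
    where
    a≁b : ¬ SameOrbit H a b
    a≁b a~b = intransitive λ x y → sameOrbit-trans (sameOrbit-sym (from-a x)) (from-a y)
      where
      from-a : ∀ x → SameOrbit H a x
      from-a x = [ (λ a~x → a~x) , sameOrbit-trans a~b ]′ (cover x)

  OrbitColouring : (Fin n → Bool) → Set
  OrbitColouring c = ∀ x y → SameOrbit H x y ⇔ (c x ≡ c y)

  orbitColouring : ExactlyTwoOrbits H → Σ (Fin n → Bool) OrbitColouring
  orbitColouring (a , b , a≁b , cover) = colour , λ x y → mk⇔ (to x y) (from x y)
    where
    colour : Fin n → Bool
    colour x = [ const true , const false ]′ (cover x)

    colour-spec : ∀ x → (colour x ≡ true × SameOrbit H a x) ⊎ (colour x ≡ false × SameOrbit H b x)
    colour-spec x with cover x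
    ... | inj₁ a~x = inj₁ (refl , a~x)
    ... | inj₂ b~x = inj₂ (refl , b~x)

    to : ∀ x y → SameOrbit H x y → colour x ≡ colour y
    to x y x~y with colour-spec x | colour-spec y
    ... | inj₁ (cx , _)   | inj₁ (cy , _)   = trans cx (sym cy)
    ... | inj₂ (cx , _)   | inj₂ (cy , _)   = trans cx (sym cy)
    ... | inj₁ (_ , a~x)  | inj₂ (_ , b~y)  =
      contradiction (sameOrbit-trans (sameOrbit-trans a~x x~y) (sameOrbit-sym b~y)) a≁b
    ... | inj₂ (_ , b~x)  | inj₁ (_ , a~y)  =
      contradiction (sameOrbit-trans (sameOrbit-trans a~y (sameOrbit-sym x~y)) (sameOrbit-sym b~x)) a≁b

    from : ∀ x y → colour x ≡ colour y → SameOrbit H x y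
    from x y cx≡cy with colour-spec x | colour-spec y
    ... | inj₁ (_ , a~x)  | inj₁ (_ , a~y)  = sameOrbit-trans (sameOrbit-sym a~x) a~y
    ... | inj₂ (_ , b~x)  | inj₂ (_ , b~y)  = sameOrbit-trans (sameOrbit-sym b~x) b~y
    ... | inj₁ (cx , _)   | inj₂ (cy , _)   = contradiction (trans (sym cx) (trans cx≡cy cy)) λ ()
    ... | inj₂ (cx , _)   | inj₁ (cy , _)   = contradiction (trans (sym cy) (trans (sym cx≡cy) cx)) λ ()

  orbitColouring-preserved : ∀ {c h} → OrbitColouring c → h ∈ₛ H → Preserves c h
  orbitColouring-preserved {h = h} oc h∈H x = sym (Equivalence.to (oc x (h ⟨$⟩ʳ x)) (h , h∈H , refl))

  invariant-colour-classes-are-orbits : ∀ {c u v x y} → AtMostTwoOrbits H →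
    (∀ h → h ∈ₛ H → Preserves c h) → c u ≢ c v → c x ≡ c y → SameOrbit H x y
  invariant-colour-classes-are-orbits {c} {u} {v} {x} {y} (a , b , cover) invariant cu≢cv cx≡cy =
    join (cover x) (cover y)
    where
    orbit-colour : ∀ {p q} → SameOrbit H p q → c p ≡ c q
    orbit-colour {p} (h , h∈H , refl) = sym (invariant h h∈H p)

    ca≢cb : c a ≢ c b
    ca≢cb ca≡cb = cu≢cv (trans (colour-of-a u) (sym (colour-of-a v)))
      where
      colour-of-a : ∀ z → c z ≡ c a
      colour-of-a z = [ (λ a~z → sym (orbit-colour a~z)) ,
                        (λ b~z → trans (sym (orbit-colour b~z)) (sym ca≡cb)) ]′ (cover z)

    join : SameOrbit H a x ⊎ SameOrbit H b x → SameOrbit H a y ⊎ SameOrbit H b y → SameOrbit H x y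
    join (inj₁ a~x) (inj₁ a~y) = sameOrbit-trans (sameOrbit-sym a~x) a~y
    join (inj₂ b~x) (inj₂ b~y) = sameOrbit-trans (sameOrbit-sym b~x) b~y
    join (inj₁ a~x) (inj₂ b~y) =
      contradiction (trans (orbit-colour a~x) (trans cx≡cy (sym (orbit-colour b~y)))) ca≢cb
    join (inj₂ b~x) (inj₁ a~y) =
      contradiction (trans (orbit-colour a~y) (trans (sym cx≡cy) (sym (orbit-colour b~x)))) ca≢cb

module _ {n : ℕ} (Γ : Graph n) where

  ProperColouring : (Fin n → Bool) → Set
  ProperColouring c = ∀ x y → Edge Γ x y → c x ≢ c y

  neighbour-colour : ∀ {c x y} → ProperColouring c → Edge Γ x y → c y ≡ not (c x)
  neighbour-colour {x = x} {y} proper x—y = ¬-not (proper x y x—y ∘ sym)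

  complement-proper : ∀ {c} → ProperColouring c → ProperColouring (not ∘ c)
  complement-proper proper x y x—y = proper x y x—y ∘ not-injective

  automorphism-proper : ∀ {c g} → IsAut Γ g → ProperColouring c → ProperColouring (c ∘ (g ⟨$⟩ʳ_))
  automorphism-proper aut proper x y x—y = proper _ _ (trans (aut x y) x—y)

  agreement-along-walk : ∀ {c d x y} → ProperColouring c → ProperColouring d →
                         Walk Γ x y → c x ≡ d x → c y ≡ d y
  agreement-along-walk pc pd here agree = agree
  agreement-along-walk {c} {d} pc pd (step {x} {y} x—y walk) agree =
    agreement-along-walk pc pd walk (begin
      c y        ≡⟨ neighbour-colour pc x—y ⟩
      not (c x)  ≡⟨ cong not agree ⟩
      not (d x)  ≡⟨ neighbour-colour pd x—y ⟨
      d y        ∎)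
    where open ≡-Reasoning

  proper-colourings-agree-or-complement : ∀ {c d} → Connected Γ →
    ProperColouring c → ProperColouring d → Fin n →
    (∀ y → c y ≡ d y) ⊎ (∀ y → c y ≡ not (d y))
  proper-colourings-agree-or-complement {c} {d} connected pc pd x with c x ≟ᵇ d x
  ... | yes agree    = inj₁ λ y → agreement-along-walk pc pd (connected x y) agree
  ... | no  disagree =
    inj₂ λ y → agreement-along-walk pc (complement-proper pd) (connected x y) (¬-not disagree)

  proper-colour-classes-unique : ∀ {c d x y} → Connected Γ →
    ProperColouring c → ProperColouring d → c x ≡ c y → d x ≡ d y
  proper-colour-classes-unique {x = x} {y} connected pc pd cx≡cy
    with proper-colourings-agree-or-complement connected pc pd x
  ... | inj₁ agree      = trans (sym (agree x)) (trans cx≡cy (agree y))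
  ... | inj₂ complement = not-injective (trans (sym (complement x)) (trans cx≡cy (complement y)))

  automorphism-preserves-or-swaps : ∀ {c g} → Connected Γ → IsAut Γ g →
    ProperColouring c → Fin n → Preserves c g ⊎ Swaps c g
  automorphism-preserves-or-swaps {g = g} connected aut proper x
    with proper-colourings-agree-or-complement connected (automorphism-proper {g = g} aut proper) proper x
  ... | inj₁ agree      = inj₁ agree
  ... | inj₂ complement = inj₂ λ y → ≡-not⇒≢ (complement y)

module _ {n : ℕ} (Γ : Graph n) (G N : Subgroup n) (N⊴G : IsNormal N G)
         (connected : Connected Γ) (edge-transitive : EdgeTransitive Γ G) where

  conjugate-sameOrbit : ∀ {g x y} → g ∈ₛ G → SameOrbit N x y →
                        SameOrbit N (g ⟨$⟩ʳ x) (g ⟨$⟩ʳ y)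
  conjugate-sameOrbit {g} g∈G (ν , ν∈N , refl) =
    conjugate g ν , proj₂ N⊴G g ν g∈G ν∈N , cong (λ z → g ⟨$⟩ʳ (ν ⟨$⟩ʳ z)) (inverseˡ g)

  intransitive-normal-orbits-independent : ¬ Transitive N →
    ∀ {x y} → Edge Γ x y → ¬ SameOrbit N x y
  intransitive-normal-orbits-independent intransitive {x} {y} x—y x~y =
    intransitive λ u v → along (connected u v)
    where
    edge-within-orbit : ∀ u v → Edge Γ u v → SameOrbit N u v
    edge-within-orbit u v u—v with edge-transitive x y u v x—y u—v
    ... | g , g∈G , inj₁ (gx≡u , gy≡v) = subst₂ (SameOrbit N) gx≡u gy≡v (conjugate-sameOrbit g∈G x~y)
    ... | g , g∈G , inj₂ (gx≡v , gy≡u) =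
      sameOrbit-sym N (subst₂ (SameOrbit N) gx≡v gy≡u (conjugate-sameOrbit g∈G x~y))

    along : ∀ {u v} → Walk Γ u v → SameOrbit N u v
    along here            = sameOrbit-refl N _
    along (step u—w walk) = sameOrbit-trans N (edge-within-orbit _ _ u—w) (along walk)

  normal-orbitColouring : ExactlyTwoOrbits N →
    Σ (Fin n → Bool) λ c → ProperColouring Γ c × OrbitColouring N c
  normal-orbitColouring twoOrbits@(a , b , a≁b , _) with orbitColouring N twoOrbits
  ... | c , oc = c , proper , oc
    where
    proper : ProperColouring Γ c
    proper x y x—y cx≡cy =
      intransitive-normal-orbits-independent (λ transitive → a≁b (transitive a b)) x—y
        (Equivalence.from (oc x y) cx≡cy)

  intransitive-normal-orbits-are-colour-classes : ∀ {Δ} → ProperColouring Γ Δ →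
    AtMostTwoOrbits N → ¬ Transitive N → OrbitColouring N Δ
  intransitive-normal-orbits-are-colour-classes {Δ} Δ-proper atMostTwo intransitive x y
    with normal-orbitColouring (intransitive⇒exactlyTwoOrbits N atMostTwo intransitive)
  ... | c , c-proper , oc =
    mk⇔ (proper-colour-classes-unique Γ connected c-proper Δ-proper ∘ Equivalence.to (oc x y))
        (Equivalence.from (oc x y) ∘ proper-colour-classes-unique Γ connected Δ-proper c-proper)

-- The product K × K′ of the kernels of G⁺ on the two colour classes, described elementwise:
-- m ∈ G⁺ belongs to it iff on each class it agrees with an element of G fixing the other class.
module KernelProduct {n : ℕ} (G : Subgroup n) (Δ : Fin n → Bool) where

  RealisedFixing : Bool → Permutation′ n → Set
  RealisedFixing b m = Σ (Permutation′ n) λ k → k ∈ₛ G × FixesClass Δ b k ×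
                         (∀ x → Δ x ≡ not b → k ⟨$⟩ʳ x ≡ m ⟨$⟩ʳ x)

  realisedFixing-comp : ∀ {π ρ} b → Preserves Δ π →
    RealisedFixing b π → RealisedFixing b ρ → RealisedFixing b (π ∘ₚ ρ)
  realisedFixing-comp {π} b π-pres (k , k∈G , k-fix , k≈π) (l , l∈G , l-fix , l≈ρ) =
    k ∘ₚ l , ∈-comp G k∈G l∈G ,
    (λ x Δx≡b → trans (cong (l ⟨$⟩ʳ_) (k-fix x Δx≡b)) (l-fix x Δx≡b)) ,
    (λ x Δx≡¬b → trans (cong (l ⟨$⟩ʳ_) (k≈π x Δx≡¬b)) (l≈ρ (π ⟨$⟩ʳ x) (trans (π-pres x) Δx≡¬b)))

  realisedFixing-inverse : ∀ {π} b → Preserves Δ π → RealisedFixing b π → RealisedFixing b (flip π)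
  realisedFixing-inverse {π} b π-pres (k , k∈G , k-fix , k≈π) =
    flip k , ∈-inv G k∈G ,
    (λ x Δx≡b → trans (cong (k ⟨$⟩ˡ_) (sym (k-fix x Δx≡b))) (inverseˡ k)) ,
    (λ x Δx≡¬b → trans (cong (k ⟨$⟩ˡ_) (sym (k-on-π⁻¹ x Δx≡¬b))) (inverseˡ k))
    where
    k-on-π⁻¹ : ∀ x → Δ x ≡ not b → k ⟨$⟩ʳ (π ⟨$⟩ˡ x) ≡ x
    k-on-π⁻¹ x Δx≡¬b =
      trans (k≈π (π ⟨$⟩ˡ x) (trans (preserves-inverse π π-pres x) Δx≡¬b)) (inverseʳ π)

  realisedFixing-conjugate : ∀ {h m b b′} → h ∈ₛ G →
    (∀ x → Δ x ≡ b → Δ (h ⟨$⟩ˡ x) ≡ b′) → (∀ x → Δ x ≡ not b → Δ (h ⟨$⟩ˡ x) ≡ not b′) →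
    RealisedFixing b′ m → RealisedFixing b (conjugate h m)
  realisedFixing-conjugate {h} h∈G b↦b′ ¬b↦¬b′ (k , k∈G , k-fix , k≈m) =
    conjugate h k , ∈-comp G (∈-comp G (∈-inv G h∈G) k∈G) h∈G ,
    (λ x Δx≡b → trans (cong (h ⟨$⟩ʳ_) (k-fix (h ⟨$⟩ˡ x) (b↦b′ x Δx≡b))) (inverseʳ h)) ,
    (λ x Δx≡¬b → cong (h ⟨$⟩ʳ_) (k≈m (h ⟨$⟩ˡ x) (¬b↦¬b′ x Δx≡¬b)))

  InKernelProduct : Permutation′ n → Set
  InKernelProduct m = m ∈ₛ G × Preserves Δ m × (∀ b → RealisedFixing b m)

  kernelProduct : Subgroup n
  kernelProduct = record
    { _∈_    = InKernelProduct
    ; ∈-resp = λ {π} {ρ} π≈ρ (π∈G , π-pres , π-real) →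
        ∈-resp G π≈ρ π∈G ,
        (λ x → trans (cong Δ (sym (π≈ρ x))) (π-pres x)) ,
        (λ b → let (k , k∈G , k-fix , k≈π) = π-real b
               in k , k∈G , k-fix , λ x Δx≡¬b → trans (k≈π x Δx≡¬b) (π≈ρ x))
    ; ∈-id   = ∈-id G , (λ _ → refl) , (λ _ → id , ∈-id G , (λ _ _ → refl) , (λ _ _ → refl))
    ; ∈-comp = λ {π} {ρ} (π∈G , π-pres , π-real) (ρ∈G , ρ-pres , ρ-real) →
        ∈-comp G π∈G ρ∈G , (λ x → trans (ρ-pres (π ⟨$⟩ʳ x)) (π-pres x)) ,
        (λ b → realisedFixing-comp {π} {ρ} b π-pres (π-real b) (ρ-real b))
    ; ∈-inv  = λ {π} (π∈G , π-pres , π-real) →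
        ∈-inv G π∈G , preserves-inverse π π-pres ,
        (λ b → realisedFixing-inverse {π} b π-pres (π-real b))
    }

  kernelProduct-normal : (∀ g → g ∈ₛ G → Preserves Δ g ⊎ Swaps Δ g) → IsNormal kernelProduct G
  kernelProduct-normal preserves-or-swaps = (λ _ → proj₁) , conjugate-closed
    where
    conjugate-closed : ∀ h m → h ∈ₛ G → InKernelProduct m → InKernelProduct (conjugate h m)
    conjugate-closed h m h∈G (m∈G , m-pres , m-real) with preserves-or-swaps h h∈G
    ... | inj₁ h-pres =
      conjugate∈G , (λ x → trans (h-pres _) (trans (m-pres _) (h⁻¹-pres x))) ,
      (λ b → realisedFixing-conjugate {m = m} h∈G (λ x → trans (h⁻¹-pres x)) (λ x → trans (h⁻¹-pres x)) (m-real b))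
      where
      conjugate∈G : conjugate h m ∈ₛ G
      conjugate∈G = ∈-comp G (∈-comp G (∈-inv G h∈G) m∈G) h∈G
      h⁻¹-pres : Preserves Δ (flip h)
      h⁻¹-pres = preserves-inverse h h-pres
    ... | inj₂ h-swaps =
      conjugate∈G ,
      (λ x → trans (≢-common⇒≡ (λ eq → h-swaps _ (trans eq (sym (m-pres _)))) (h-swaps (h ⟨$⟩ˡ x)))
                   (cong Δ (inverseʳ h))) ,
      (λ b → realisedFixing-conjugate {m = m} h∈G (λ x → trans (h⁻¹-swaps x) ∘ cong not)
                                         (λ x → trans (h⁻¹-swaps x) ∘ cong not) (m-real (not b)))
      where
      conjugate∈G : conjugate h m ∈ₛ G
      conjugate∈G = ∈-comp G (∈-comp G (∈-inv G h∈G) m∈G) h∈G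
      h⁻¹-swaps : ∀ x → Δ (h ⟨$⟩ˡ x) ≡ not (Δ x)
      h⁻¹-swaps = swaps-inverse h h-swaps

module _ {n : ℕ} (Γ : Graph n) (G : Subgroup n) (Δ : Fin n → Bool)
         (aut : SubgroupOfAut Γ G) (Δ-proper : ProperColouring Γ Δ) where

  FixersTransitiveOnOtherClass : Set
  FixersTransitiveOnOtherClass = ∀ b x y → Δ x ≡ Δ y → Δ x ≡ not b →
    Σ (Permutation′ n) λ k → k ∈ₛ G × FixesClass Δ b k × k ⟨$⟩ʳ x ≡ y

  -- Move the tail with an element fixing the head's class, then the head with one fixing the tail's.
  fixersTransitive⇒arcTransitive-within-class : FixersTransitiveOnOtherClass →
    ∀ x y u v → Edge Γ x y → Edge Γ u v → Δ x ≡ Δ u →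
    Σ (Permutation′ n) λ h → h ∈ₛ G × (h ⟨$⟩ʳ x ≡ u × h ⟨$⟩ʳ y ≡ v)
  fixersTransitive⇒arcTransitive-within-class fixers x y u v x—y u—v Δx≡Δu
    with fixers (Δ y) x u Δx≡Δu (¬-not (Δ-proper x y x—y))
       | fixers (Δ u) y v Δy≡Δv (trans Δy≡Δv (neighbour-colour Γ Δ-proper u—v))
    where
    Δy≡Δv : Δ y ≡ Δ v
    Δy≡Δv = ≢-common⇒≡ (Δ-proper x y x—y ∘ sym) (λ Δv≡Δx → Δ-proper u v u—v (sym (trans Δv≡Δx Δx≡Δu)))
  ... | k , k∈G , k-fix , kx≡u | l , l∈G , l-fix , ly≡v =
    k ∘ₚ l , ∈-comp G k∈G l∈G ,
    trans (cong (l ⟨$⟩ʳ_) kx≡u) (l-fix u refl) ,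
    trans (cong (l ⟨$⟩ʳ_) (k-fix y refl)) ly≡v

  fixersTransitive⇒arcTransitive : FixersTransitiveOnOtherClass →
    ∀ {s} → s ∈ₛ G → Swaps Δ s → ArcTransitive Γ G
  fixersTransitive⇒arcTransitive fixers {s} s∈G s-swaps x y u v x—y u—v with Δ x ≟ᵇ Δ u
  ... | yes Δx≡Δu = fixersTransitive⇒arcTransitive-within-class fixers x y u v x—y u—v Δx≡Δu
  ... | no  Δx≢Δu
    with fixersTransitive⇒arcTransitive-within-class fixers (s ⟨$⟩ʳ x) (s ⟨$⟩ʳ y) u v
           (trans (aut s s∈G x y) x—y) u—v (≢-common⇒≡ (s-swaps x) (Δx≢Δu ∘ sym))
  ... | h , h∈G , sx↦u , sy↦v = s ∘ₚ h , ∈-comp G s∈G h∈G , sx↦u , sy↦v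

  module _ (preserves-or-swaps : ∀ g → g ∈ₛ G → Preserves Δ g ⊎ Swaps Δ g)
           (atMostTwoOrbits : ∀ N → IsNormal N G → Nontrivial N → AtMostTwoOrbits N)
           {u v : Fin n} (Δu≢Δv : Δ u ≢ Δ v) where

    open KernelProduct G Δ

    nontrivial-kernel⇒fixersTransitive : ∀ {b g z} → g ∈ₛ G → Preserves Δ g →
      FixesClass Δ b g → g ⟨$⟩ʳ z ≢ z → FixersTransitiveOnOtherClass
    nontrivial-kernel⇒fixersTransitive {b} {g} {z} g∈G g-pres g-fix moved c x y Δx≡Δy Δx≡¬c
      with invariant-colour-classes-are-orbits kernelProduct
             (atMostTwoOrbits kernelProduct (kernelProduct-normal preserves-or-swaps) nontrivial)
             (λ _ → proj₁ ∘ proj₂) Δu≢Δv Δx≡Δy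
      where
      g-realised : ∀ c → RealisedFixing c g
      g-realised c with c ≟ᵇ b
      ... | yes refl = g , g∈G , g-fix , (λ _ _ → refl)
      ... | no  c≢b  = id , ∈-id G , (λ _ _ → refl) ,
        (λ x Δx≡¬c → sym (g-fix x (trans Δx≡¬c (sym (¬-not (c≢b ∘ sym))))))

      nontrivial : Nontrivial kernelProduct
      nontrivial = g , (g∈G , g-pres , g-realised) , z , moved
    ... | m , (_ , _ , m-realised) , mx≡y with m-realised c
    ... | k , k∈G , k-fix , k≈m = k , k∈G , k-fix , trans (k≈m x Δx≡¬c) mx≡y

    kernel-on-class-trivial : ¬ ArcTransitive Γ G → ∀ {s} → s ∈ₛ G → Swaps Δ s →
      ∀ (b : Bool) g → g ∈ₛ G → Preserves Δ g → FixesClass Δ b g → ∀ x → g ⟨$⟩ʳ x ≡ x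
    kernel-on-class-trivial ¬arcTransitive s∈G s-swaps b g g∈G g-pres g-fix x with g ⟨$⟩ʳ x ≟ᶠ x
    ... | yes fixed = fixed
    ... | no  moved = contradiction
      (fixersTransitive⇒arcTransitive (nontrivial-kernel⇒fixersTransitive g∈G g-pres g-fix moved) s∈G s-swaps)
      ¬arcTransitive

lemma3p1 : (n : ℕ) (Γ : Graph n) (G : Subgroup n) →
    Connected Γ → FourValent Γ → SubgroupOfAut Γ G →
    Oriented Γ G → BasicBiquasiprimitive Γ G →
    -- Δ : Fin n → Bool is the bipartition: Δ = {x | Δ x ≡ true}, Δ' = {x | Δ x ≡ false}
    Σ (Fin n → Bool) λ Δ →
      -- Γ is bipartite with biparts Δ , Δ' (both nonempty)
      (∀ x y → Edge Γ x y → Δ x ≢ Δ y) ×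
      (∃ λ x → Δ x ≡ true) × (∃ λ x → Δ x ≡ false) ×
      -- G⁺ = {g ∈ G | g fixes Δ setwise} has index two in G:
      -- every g ∈ G preserves or swaps the biparts, and some g ∈ G swaps them
      (∀ g → _∈_ G g → (∀ x → Δ (g ⟨$⟩ʳ x) ≡ Δ x) ⊎ (∀ x → Δ (g ⟨$⟩ʳ x) ≢ Δ x)) ×
      (Σ (Permutation′ n) λ g → _∈_ G g × ∃ λ x → Δ (g ⟨$⟩ʳ x) ≢ Δ x) ×
      -- the orbits of G⁺ are Δ and Δ'
      (∀ x y → Δ x ≡ Δ y →
        Σ (Permutation′ n) λ g → _∈_ G g × (∀ z → Δ (g ⟨$⟩ʳ z) ≡ Δ z) × g ⟨$⟩ʳ x ≡ y) ×
      -- (a) G⁺ acts faithfully on Δ and on Δ'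
      (∀ (b : Bool) g → _∈_ G g → (∀ z → Δ (g ⟨$⟩ʳ z) ≡ Δ z) →
        (∀ x → Δ x ≡ b → g ⟨$⟩ʳ x ≡ x) → ∀ x → g ⟨$⟩ʳ x ≡ x) ×
      -- (b) every nontrivial normal intransitive N has orbits exactly Δ , Δ' ; so N ≤ G⁺
      (∀ N → IsNormal N G → Nontrivial N → ¬ Transitive N →
        (∀ x y → SameOrbit N x y ⇔ (Δ x ≡ Δ y)) ×
        (∀ ν → _∈_ N ν → ∀ x → Δ (ν ⟨$⟩ʳ x) ≡ Δ x))
lemma3p1 n Γ G connected _ aut (G-transitive , edge-transitive , ¬arcTransitive)
         (atMostTwoOrbits , N₀ , N₀⊴G , _ , N₀-twoOrbits@(a₀ , b₀ , a₀≁b₀ , _))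
  with normal-orbitColouring Γ G N₀ N₀⊴G connected edge-transitive N₀-twoOrbits
     | G-transitive a₀ b₀
... | Δ , Δ-proper , N₀-orbits | s , s∈G , sa₀≡b₀ =
  Δ , Δ-proper , proj₁ both-classes-inhabited , proj₂ both-classes-inhabited , preserves-or-swaps , (s , s∈G , a₀ , s-moves-a₀) ,
  G⁺-transitive-on-classes ,
  kernel-on-class-trivial Γ G Δ aut Δ-proper preserves-or-swaps atMostTwoOrbits Δa₀≢Δb₀
    ¬arcTransitive s∈G (moves-colour⇒swaps {c = Δ} {s} {a₀} (preserves-or-swaps s s∈G) s-moves-a₀) ,
  λ N N⊴G nontrivial intransitive →
    let N-orbits = intransitive-normal-orbits-are-colour-classes Γ G N N⊴G connected edge-transitive
                     Δ-proper (atMostTwoOrbits N N⊴G nontrivial) intransitive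
    in N-orbits , λ ν ν∈N → orbitColouring-preserved N N-orbits ν∈N
  where
  Δa₀≢Δb₀ : Δ a₀ ≢ Δ b₀
  Δa₀≢Δb₀ = a₀≁b₀ ∘ Equivalence.from (N₀-orbits a₀ b₀)

  both-classes-inhabited : (∃ λ x → Δ x ≡ true) × (∃ λ x → Δ x ≡ false)
  both-classes-inhabited = both-colours-used Δ Δa₀≢Δb₀

  preserves-or-swaps : ∀ g → g ∈ₛ G → Preserves Δ g ⊎ Swaps Δ g
  preserves-or-swaps g g∈G = automorphism-preserves-or-swaps Γ {g = g} connected (aut g g∈G) Δ-proper a₀

  s-moves-a₀ : Δ (s ⟨$⟩ʳ a₀) ≢ Δ a₀
  s-moves-a₀ Δsa₀≡Δa₀ = Δa₀≢Δb₀ (trans (sym Δsa₀≡Δa₀) (cong Δ sa₀≡b₀))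

  G⁺-transitive-on-classes : ∀ x y → Δ x ≡ Δ y →
    Σ (Permutation′ n) λ g → g ∈ₛ G × Preserves Δ g × g ⟨$⟩ʳ x ≡ y
  G⁺-transitive-on-classes x y Δx≡Δy with Equivalence.from (N₀-orbits x y) Δx≡Δy
  ... | ν , ν∈N₀ , νx≡y = ν , proj₁ N₀⊴G ν ν∈N₀ , orbitColouring-preserved N₀ N₀-orbits ν∈N₀ , νx≡y
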